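{- Let $p$ be a prime and let $q \ge 2$ be an integer coprime to $p$. Let $R = F_p[x_1,\ldots,x_n]/(x_1^2 - x_1,\ldots,x_n^2 - x_n)$ and let $\chi_q \in R$ be the function with $\chi_q(x) = 1$ if $q$ divides $|x| = x_1+\cdots+x_n$ and $\chi_q(x)=0$ otherwise. If $f$ belongs to the ideal $\langle \chi_q\rangle$ of $R$, then either $f = 0$ or $\deg(f) \ge n/2$.
   Context: Every element of $R$ has a unique multilinear polynomial representative, and $R$ is identified with the algebra of functions $\{0,1\}^n \to F_p$ (via evaluation). The degree of an element of $R$ is the degree of its multilinear representative. $\langle \chi_q \rangle$ denotes the ideal of $R$ generated by $\chi_q$. -}

module Defs where

open import Data.Nat as ℕ using (ℕ; zero; suc)
open import Data.Nat.Divisibility using (_∣?_)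
open import Data.Bool using (Bool; true; false; if_then_else_)
open import Data.Vec using (Vec; []; _∷_)
open import Data.List using (List; []; _∷_; map; _++_)
open import Data.Integer using (ℤ; +_; _-_; _*_; _+_)
import Data.Integer.Divisibility as ℤDiv
open import Relation.Nullary.Decidable using (does)

-- Points of {0,1}^n (false = 0, true = 1); also used for subsets S ⊆ {1..n}.
Cube : ℕ → Set
Cube n = Vec Bool n

allCube : (n : ℕ) → List (Cube n)
allCube zero = [] ∷ []
allCube (suc n) = map (false ∷_) (allCube n) ++ map (true ∷_) (allCube n)

sumℤ : List ℤ → ℤ
sumℤ [] = + 0
sumℤ (x ∷ xs) = x + sumℤ xs

weight : ∀ {n} → Cube n → ℕ
weight [] = 0
weight (true ∷ x) = suc (weight x)
weight (false ∷ x) = weight x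

bit : Bool → ℤ
bit true = + 1
bit false = + 0

monomial : ∀ {n} → Cube n → Cube n → ℤ
monomial [] [] = + 1
monomial (s ∷ S) (b ∷ x) = (if s then bit b else + 1) * monomial S x

evalML : ∀ {n} → (Cube n → ℤ) → Cube n → ℤ
evalML {n} c x = sumℤ (map (λ S → c S * monomial S x) (allCube n))

-- Congruence modulo p (F_p elements are represented by integers mod p).
_≡_[mod_] : ℤ → ℤ → ℕ → Set
a ≡ b [mod p ] = (+ p) ℤDiv.∣ (a - b)

χ : (q : ℕ) → ∀ {n} → Cube n → ℤ
χ q x = if does (q ∣? weight x) then + 1 else + 0

-- Work with divisibility by p and assume every coefficient c_S with 2|S| ≥ n vanishes mod p.
-- Fix a point a with q ∣ |a| and a shift r.  With σ(x) = (−1)^(n−|x|), the function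
--   ψ(x) = ∑_T σ(T) σ(x) 𝟙[q ∣ |a ∩ T| + |T̄ ∖ x| + r]
-- vanishes for x ≠ a (flip T at a coordinate where x and a differ) and, by a recursion on
-- the coordinates, equals Δⁿ𝟙[q ∣ _](r) at x = a.  Adding |x| to the level in the summands
-- with 2|T| < n yields a function φ that agrees with ψ where q ∣ |x|, and each of whose
-- summands is odd under flipping a coordinate outside S when 2|S| < n; so φ is orthogonal
-- to such x^S.  As f vanishes mod p where q ∤ |x| and is congruent to a polynomial of
-- degree < n/2, pairing f with φ gives f(a)·Δⁿ𝟙[q ∣ _](r) ≡ 0 for every r.  Since
-- 𝟙[q ∣ _] is q-periodic and q is invertible mod p, this forces f(a) ≡ 0.

module Submission where

open import Defs
open import Algebra.Properties.CommutativeSemigroup using (interchange; xy∙z≈xz∙y)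
open import Data.Bool using (Bool; true; false; not; if_then_else_)
import Data.Bool.Properties as Bool
open import Data.Bool.Properties using (¬-not)
open import Data.Empty using (⊥-elim)
open import Data.Fin using (Fin; zero; suc)
open import Data.Fin.Subset.Properties using (anySubset?)
open import Data.Integer using (ℤ; +_; _+_; _-_; -_; _*_; -1ℤ)
import Data.Integer as ℤ
import Data.Integer.Coprimality as ℤ
open import Data.Integer.Divisibility.Signed
  using (_∣_; divides; ∣ᵤ⇒∣; ∣⇒∣ᵤ; ∣m∣n⇒∣m+n; ∣m∣n⇒∣m-n; ∣m⇒∣-m; ∣m⇒∣m*n)
import Data.Integer.Properties as ℤ
open import Data.Integer.Properties
  using (+-identityˡ; +-identityʳ; +-assoc; +-comm; +-inverseʳ; *-assoc; *-comm; *-zeroʳ;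
         *-identityˡ; *-identityʳ; *-distribˡ-+; neg-distrib-+; neg-distribˡ-*; neg-distribʳ-*; pos-+)
open import Data.Integer.Tactic.RingSolver using (solve-∀)
open import Data.List using ([]; _∷_; map; _++_)
open import Data.List.Properties using (map-++; map-∘)
open import Data.Nat as ℕ using (ℕ; zero; suc; _≤_; _<_)
import Data.Nat.Divisibility as ℕ
import Data.Nat.Properties as ℕ
open import Data.Nat.Coprimality using (Coprime) renaming (sym to coprime-sym)
open import Data.Nat.Primality using (Prime)
open import Data.Product using (Σ; ∃; _×_; _,_)
import Data.Product as Product
open import Data.Sum using (_⊎_; inj₁; inj₂)
import Data.Sum as Sum
open import Data.Vec using ([]; _∷_; lookup; tail)
open import Function using (_∘_; id)
open import Relation.Binary.PropositionalEquality
open import Relation.Nullary using (¬_; yes; no; does)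
open import Relation.Nullary.Decidable using (¬?; _×-dec_; dec-true; dec-false)

∑ : ∀ {n} → (Cube n → ℤ) → ℤ
∑ {zero}  h = h []
∑ {suc n} h = ∑ (h ∘ (false ∷_)) + ∑ (h ∘ (true ∷_))

∑-cong : ∀ {n} {h k : Cube n → ℤ} → (∀ x → h x ≡ k x) → ∑ h ≡ ∑ k
∑-cong {zero}  h≗k = h≗k []
∑-cong {suc n} h≗k = cong₂ _+_ (∑-cong (h≗k ∘ (false ∷_))) (∑-cong (h≗k ∘ (true ∷_)))

∑-0 : ∀ {n} → ∑ {n} (λ _ → + 0) ≡ + 0
∑-0 {zero}  = refl
∑-0 {suc n} = cong₂ _+_ (∑-0 {n}) (∑-0 {n})

∑-+ : ∀ {n} (h k : Cube n → ℤ) → ∑ (λ x → h x + k x) ≡ ∑ h + ∑ k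
∑-+ {zero}  h k = refl
∑-+ {suc n} h k = trans (cong₂ _+_ (∑-+ h₀ k₀) (∑-+ h₁ k₁))
                        (interchange ℤ.+-commutativeSemigroup (∑ h₀) (∑ k₀) (∑ h₁) (∑ k₁))
  where
  h₀ = h ∘ (false ∷_); h₁ = h ∘ (true ∷_); k₀ = k ∘ (false ∷_); k₁ = k ∘ (true ∷_)

∑-neg : ∀ {n} (h : Cube n → ℤ) → ∑ (λ x → - h x) ≡ - ∑ h
∑-neg {zero}  h = refl
∑-neg {suc n} h = trans (cong₂ _+_ (∑-neg (h ∘ (false ∷_))) (∑-neg (h ∘ (true ∷_))))
                        (sym (neg-distrib-+ (∑ (h ∘ (false ∷_))) _))

∑-sub : ∀ {n} (h k : Cube n → ℤ) → ∑ (λ x → h x - k x) ≡ ∑ h - ∑ k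
∑-sub h k = trans (∑-+ h (-_ ∘ k)) (cong (λ s → ∑ h + s) (∑-neg k))

∑-*ˡ : ∀ {n} m (h : Cube n → ℤ) → ∑ (λ x → m * h x) ≡ m * ∑ h
∑-*ˡ {zero}  m h = refl
∑-*ˡ {suc n} m h = trans (cong₂ _+_ (∑-*ˡ m (h ∘ (false ∷_))) (∑-*ˡ m (h ∘ (true ∷_))))
                          (sym (*-distribˡ-+ m (∑ (h ∘ (false ∷_))) _))

∑-*ʳ : ∀ {n} m (h : Cube n → ℤ) → ∑ (λ x → h x * m) ≡ ∑ h * m
∑-*ʳ m h = trans (∑-cong (λ x → *-comm (h x) m)) (trans (∑-*ˡ m h) (*-comm m (∑ h)))

∑-swap : ∀ {n k} (H : Cube n → Cube k → ℤ) → ∑ (λ x → ∑ (H x)) ≡ ∑ (λ y → ∑ (λ x → H x y))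
∑-swap {zero}  H = refl
∑-swap {suc n} H = trans (cong₂ _+_ (∑-swap (H ∘ (false ∷_))) (∑-swap (H ∘ (true ∷_))))
  (sym (∑-+ (λ y → ∑ (λ x → H (false ∷ x) y)) (λ y → ∑ (λ x → H (true ∷ x) y))))

sumℤ-++ : ∀ xs ys → sumℤ (xs ++ ys) ≡ sumℤ xs + sumℤ ys
sumℤ-++ []       ys = sym (+-identityˡ _)
sumℤ-++ (x ∷ xs) ys = trans (cong (λ s → x + s) (sumℤ-++ xs ys)) (sym (+-assoc x _ _))

sumℤ-allCube : ∀ n (h : Cube n → ℤ) → sumℤ (map h (allCube n)) ≡ ∑ h
sumℤ-allCube zero    h = +-identityʳ (h [])
sumℤ-allCube (suc n) h = begin
  sumℤ (map h (map (false ∷_) A ++ map (true ∷_) A))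
    ≡⟨ cong sumℤ (map-++ h (map (false ∷_) A) _) ⟩
  sumℤ (map h (map (false ∷_) A) ++ map h (map (true ∷_) A))
    ≡⟨ sumℤ-++ (map h (map (false ∷_) A)) _ ⟩
  sumℤ (map h (map (false ∷_) A)) + sumℤ (map h (map (true ∷_) A))
    ≡⟨ cong₂ (λ u v → sumℤ u + sumℤ v) (map-∘ A) (map-∘ A) ⟨
  sumℤ (map (h ∘ (false ∷_)) A) + sumℤ (map (h ∘ (true ∷_)) A)
    ≡⟨ cong₂ _+_ (sumℤ-allCube n _) (sumℤ-allCube n _) ⟩
  ∑ h ∎
  where
  open ≡-Reasoning
  A = allCube n

flipAt : ∀ {n} → Fin n → Cube n → Cube n
flipAt zero    (b ∷ x) = not b ∷ x
flipAt (suc i) (b ∷ x) = b ∷ flipAt i x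

∑-odd : ∀ {n} (i : Fin n) (h : Cube n → ℤ) → (∀ x → h (flipAt i x) ≡ - h x) → ∑ h ≡ + 0
∑-odd zero h odd = begin
  ∑ h₀ + ∑ (h ∘ (true ∷_)) ≡⟨ cong (λ s → ∑ h₀ + s) (∑-cong (odd ∘ (false ∷_))) ⟩
  ∑ h₀ + ∑ (-_ ∘ h₀)       ≡⟨ cong (λ s → ∑ h₀ + s) (∑-neg h₀) ⟩
  ∑ h₀ - ∑ h₀              ≡⟨ +-inverseʳ (∑ h₀) ⟩
  + 0                      ∎
  where
  open ≡-Reasoning
  h₀ = h ∘ (false ∷_)
∑-odd (suc i) h odd =
  cong₂ _+_ (∑-odd i _ (odd ∘ (false ∷_))) (∑-odd i _ (odd ∘ (true ∷_)))

∣0 : ∀ {d} → d ∣ + 0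
∣0 = divides (+ 0) refl

≡0⇒∣ : ∀ {d x} → x ≡ + 0 → d ∣ x
≡0⇒∣ {d} x≡0 = subst (d ∣_) (sym x≡0) ∣0

∣-∑ : ∀ {d n} {h : Cube n → ℤ} → (∀ x → d ∣ h x) → d ∣ ∑ h
∣-∑ {n = zero}  d∣h = d∣h []
∣-∑ {n = suc n} d∣h = ∣m∣n⇒∣m+n (∣-∑ (d∣h ∘ (false ∷_))) (∣-∑ (d∣h ∘ (true ∷_)))

∣-∑-∑ : ∀ {d n} {h k : Cube n → ℤ} → (∀ x → d ∣ h x - k x) → d ∣ ∑ h - ∑ k
∣-∑-∑ {d} {h = h} {k} d∣h-k = subst (d ∣_) (∑-sub h k) (∣-∑ d∣h-k)

∣-∑-at : ∀ {d n} (a : Cube n) (h : Cube n → ℤ) → (∀ x → x ≢ a → d ∣ h x) → d ∣ ∑ h - h a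
∣-∑-at [] h _ = ≡0⇒∣ (+-inverseʳ (h []))
∣-∑-at {d} (false ∷ a) h off = subst (d ∣_) (regroup (∑ (h ∘ (false ∷_))) _ _)
  (∣m∣n⇒∣m+n (∣-∑-at a (h ∘ (false ∷_)) (λ x x≢a → off (false ∷ x) (x≢a ∘ cong tail)))
             (∣-∑ (λ x → off (true ∷ x) (λ ()))))
  where
  regroup : ∀ s₀ s₁ v → (s₀ - v) + s₁ ≡ (s₀ + s₁) - v
  regroup = solve-∀
∣-∑-at {d} (true ∷ a) h off = subst (d ∣_) (regroup (∑ (h ∘ (false ∷_))) _ _)
  (∣m∣n⇒∣m+n (∣-∑ (λ x → off (false ∷ x) (λ ())))
             (∣-∑-at a (h ∘ (true ∷_)) (λ x x≢a → off (true ∷ x) (x≢a ∘ cong tail))))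
  where
  regroup : ∀ s₀ s₁ v → s₀ + (s₁ - v) ≡ (s₀ + s₁) - v
  regroup = solve-∀

𝟙[_∣_] : ℕ → ℕ → ℤ
𝟙[ q ∣ m ] = if does (q ℕ.∣? m) then + 1 else + 0

𝟙-yes : ∀ {q m} → q ℕ.∣ m → 𝟙[ q ∣ m ] ≡ + 1
𝟙-yes {q} {m} q∣m = cong (if_then + 1 else + 0) (dec-true (q ℕ.∣? m) q∣m)

𝟙-no : ∀ {q m} → ¬ q ℕ.∣ m → 𝟙[ q ∣ m ] ≡ + 0
𝟙-no {q} {m} q∤m = cong (if_then + 1 else + 0) (dec-false (q ℕ.∣? m) q∤m)

𝟙-shift : ∀ {q m w} → q ℕ.∣ w → 𝟙[ q ∣ m ℕ.+ w ] ≡ 𝟙[ q ∣ m ]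
𝟙-shift {q} {m} {w} q∣w with q ℕ.∣? m
... | yes q∣m = 𝟙-yes (ℕ.∣m∣n⇒∣m+n q∣m q∣w)
... | no  q∤m = 𝟙-no λ q∣m+w → q∤m (ℕ.∣m+n∣m⇒∣n (subst (q ℕ.∣_) (ℕ.+-comm m w) q∣m+w) q∣w)

Periodic : ℕ → (ℕ → ℤ) → Set
Periodic q h = ∀ r → h (r ℕ.+ q) ≡ h r

Δ : (ℕ → ℤ) → ℕ → ℤ
Δ h r = h (suc r) - h r

Δ^ : ℕ → (ℕ → ℤ) → ℕ → ℤ
Δ^ zero    h = h
Δ^ (suc k) h = Δ (Δ^ k h)

Δ-periodic : ∀ {q h} → Periodic q h → Periodic q (Δ h)
Δ-periodic per r = cong₂ _-_ (per (suc r)) (per r)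

Δ^𝟙-periodic : ∀ q k → Periodic q (Δ^ k 𝟙[ q ∣_])
Δ^𝟙-periodic q zero    r = 𝟙-shift (ℕ.∣-refl {q})
Δ^𝟙-periodic q (suc k) = Δ-periodic (Δ^𝟙-periodic q k)

coprime-cancel : ∀ {p q} → Coprime q p → ∀ z → + p ∣ + q * z → + p ∣ z
coprime-cancel {p} {q} q⊥p z = ∣ᵤ⇒∣ ∘ ℤ.coprime-divisor (+ p) (+ q) z (coprime-sym q⊥p) ∘ ∣⇒∣ᵤ

-- Mod p: m Δh is constant, so m (h r − h 0) ≡ r m Δh(0); at r = q periodicity makes the
-- left side vanish, and q is invertible.
annihilate-Δ : ∀ {p q} {h : ℕ → ℤ} m → Coprime q p → Periodic q h →
  (∀ r → + p ∣ m * Δ (Δ h) r) → ∀ r → + p ∣ m * Δ h r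
annihilate-Δ {p} {q} {h} m q⊥p per p∣mΔ²h r =
  subst (+ p ∣_) (cancel (m * Δ h r) _) (∣m∣n⇒∣m+n (constant r) at-0)
  where
  cancel : ∀ a b → (a - b) + b ≡ a
  cancel = solve-∀
  constant : ∀ r → + p ∣ m * Δ h r - m * Δ h 0
  constant zero    = ≡0⇒∣ (+-inverseʳ (m * Δ h 0))
  constant (suc r) = subst (+ p ∣_) (step m (Δ h (suc r)) (Δ h r) (Δ h 0))
    (∣m∣n⇒∣m+n (p∣mΔ²h r) (constant r))
    where
    step : ∀ m a b c → m * (a - b) + (m * b - m * c) ≡ m * a - m * c
    step = solve-∀
  drift : ∀ r → + p ∣ m * (h r - h 0) - + r * (m * Δ h 0)
  drift zero    = ≡0⇒∣ (vanish m (h 0) (m * Δ h 0))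
    where
    vanish : ∀ m a b → m * (a - a) - + 0 * b ≡ + 0
    vanish = solve-∀
  drift (suc r) = subst (+ p ∣_) step (∣m∣n⇒∣m+n (drift r) (constant r))
    where
    identity : ∀ m a b c d k → (m * (b - c) - k * (m * d)) + (m * (a - b) - m * d)
                             ≡ m * (a - c) - (+ 1 + k) * (m * d)
    identity = solve-∀
    step : (m * (h r - h 0) - + r * (m * Δ h 0)) + (m * Δ h r - m * Δ h 0)
         ≡ m * (h (suc r) - h 0) - + suc r * (m * Δ h 0)
    step rewrite pos-+ 1 r = identity m (h (suc r)) (h r) (h 0) (Δ h 0) (+ r)
  at-0 : + p ∣ m * Δ h 0
  at-0 = coprime-cancel q⊥p (m * Δ h 0) (subst (+ p ∣_) closing (∣m⇒∣-m (drift q)))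
    where
    identity : ∀ m a b → - (m * (a - a) - b) ≡ b
    identity = solve-∀
    closing : - (m * (h q - h 0) - + q * (m * Δ h 0)) ≡ + q * (m * Δ h 0)
    closing rewrite per 0 = identity m (h 0) (+ q * (m * Δ h 0))

Δ^𝟙-annihilator : ∀ {p q} → 2 ≤ q → Coprime q p →
  ∀ k m → (∀ r → + p ∣ m * Δ^ k 𝟙[ q ∣_] r) → + p ∣ m
Δ^𝟙-annihilator {p} {q} 2≤q q⊥p zero m p∣m𝟙 =
  subst (+ p ∣_) (trans (cong (m *_) (𝟙-yes (q ℕ.∣0))) (*-identityʳ m)) (p∣m𝟙 0)
Δ^𝟙-annihilator {p} {q} 2≤q q⊥p (suc zero) m p∣mΔ𝟙 =
  subst (+ p ∣_) negated-mΔ𝟙[0] (∣m⇒∣-m (p∣mΔ𝟙 0))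
  where
  q∤1 : ¬ q ℕ.∣ 1
  q∤1 q∣1 = ℕ.<⇒≱ 2≤q (ℕ.≤-reflexive (ℕ.∣1⇒≡1 q∣1))
  identity : ∀ m → - (m * (+ 0 - + 1)) ≡ m
  identity = solve-∀
  negated-mΔ𝟙[0] : - (m * (𝟙[ q ∣ 1 ] - 𝟙[ q ∣ 0 ])) ≡ m
  negated-mΔ𝟙[0] rewrite 𝟙-no q∤1 | 𝟙-yes (q ℕ.∣0) = identity m
Δ^𝟙-annihilator 2≤q q⊥p (suc (suc k)) m p∣mΔ^k+2 =
  Δ^𝟙-annihilator 2≤q q⊥p (suc k) m (annihilate-Δ m q⊥p (Δ^𝟙-periodic _ k) p∣mΔ^k+2)

distinct-coordinate : ∀ {n} {x a : Cube n} → x ≢ a → ∃ λ i → lookup x i ≢ lookup a i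
distinct-coordinate {x = []}    {[]}    x≢a = ⊥-elim (x≢a refl)
distinct-coordinate {x = b ∷ x} {c ∷ a} x≢a with b Bool.≟ c
... | no  b≢c  = zero , b≢c
... | yes refl with distinct-coordinate (x≢a ∘ cong (b ∷_))
...   | i , xᵢ≢aᵢ = suc i , xᵢ≢aᵢ

∃-member-of-difference : ∀ {n} (S T : Cube n) → weight S < weight T →
  ∃ λ i → lookup T i ≡ true × lookup S i ≡ false
∃-member-of-difference (false ∷ S) (true  ∷ T) _  = zero , refl , refl
∃-member-of-difference (true  ∷ S) (true  ∷ T) lt =
  Product.map suc id (∃-member-of-difference S T (ℕ.s<s⁻¹ lt))
∃-member-of-difference (false ∷ S) (false ∷ T) lt =
  Product.map suc id (∃-member-of-difference S T lt)
∃-member-of-difference (true  ∷ S) (false ∷ T) lt =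
  Product.map suc id (∃-member-of-difference S T (ℕ.<-trans (ℕ.n<1+n _) lt))

∃-nonmember-of-union : ∀ {n} (S T : Cube n) → weight S ℕ.+ weight T < n →
  ∃ λ i → lookup S i ≡ false × lookup T i ≡ false
∃-nonmember-of-union (false ∷ S) (false ∷ T) _  = zero , refl , refl
∃-nonmember-of-union (true  ∷ S) (false ∷ T) lt =
  Product.map suc id (∃-nonmember-of-union S T (ℕ.s<s⁻¹ lt))
∃-nonmember-of-union {suc n} (false ∷ S) (true  ∷ T) lt =
  Product.map suc id (∃-nonmember-of-union S T (ℕ.s<s⁻¹ (subst (_< suc n) (ℕ.+-suc _ _) lt)))
∃-nonmember-of-union {suc n} (true  ∷ S) (true  ∷ T) lt =
  Product.map suc id (∃-nonmember-of-union S T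
    (ℕ.<-trans (ℕ.n<1+n _) (subst (_< n) (ℕ.+-suc _ _) (ℕ.s<s⁻¹ lt))))

ε : Bool → ℤ
ε true  = + 1
ε false = -1ℤ

σ : ∀ {n} → Cube n → ℤ
σ []      = + 1
σ (b ∷ x) = ε b * σ x

σ-flip : ∀ {n} (i : Fin n) x → σ (flipAt i x) ≡ - σ x
σ-flip zero    (b ∷ x) = trans (cong (_* σ x) (ε-not b)) (sym (neg-distribˡ-* (ε b) (σ x)))
  where
  ε-not : ∀ b → ε (not b) ≡ - ε b
  ε-not true  = refl
  ε-not false = refl
σ-flip (suc i) (b ∷ x) = trans (cong (ε b *_) (σ-flip i x)) (sym (neg-distribʳ-* (ε b) (σ x)))

monomial-flip : ∀ {n} (i : Fin n) S x → lookup S i ≡ false → monomial S (flipAt i x) ≡ monomial S x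
monomial-flip zero    (false ∷ S) (b ∷ x) _  = refl
monomial-flip zero    (true  ∷ S) (b ∷ x) ()
monomial-flip (suc i) (s ∷ S)     (b ∷ x) Sᵢ = cong ((if s then bit b else + 1) *_) (monomial-flip i S x Sᵢ)

∑-monomial-odd : ∀ {n} (i : Fin n) S (h : Cube n → ℤ) → lookup S i ≡ false →
  (∀ x → h (flipAt i x) ≡ - h x) → ∑ (λ x → monomial S x * h x) ≡ + 0
∑-monomial-odd i S h Sᵢ odd = ∑-odd i _ λ x →
  trans (cong₂ _*_ (monomial-flip i S x Sᵢ) (odd x)) (sym (neg-distribʳ-* (monomial S x) (h x)))

bitℕ : Bool → ℕ
bitℕ true  = 1
bitℕ false = 0

weight-∷ : ∀ {n} b (x : Cube n) → weight (b ∷ x) ≡ bitℕ b ℕ.+ weight x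
weight-∷ true  x = refl
weight-∷ false x = refl

∑ᵢ : ∀ {n} → (Bool → Bool → Bool → ℕ) → Cube n → Cube n → Cube n → ℕ
∑ᵢ g []       []      []      = 0
∑ᵢ g (a ∷ as) (t ∷ T) (b ∷ x) = g a t b ℕ.+ ∑ᵢ g as T x

∑ᵢ-flipʳ : ∀ {n} g (i : Fin n) a T x →
  (∀ b → g (lookup a i) (lookup T i) (not b) ≡ g (lookup a i) (lookup T i) b) →
  ∑ᵢ g a T (flipAt i x) ≡ ∑ᵢ g a T x
∑ᵢ-flipʳ g zero    (a ∷ as) (t ∷ T) (b ∷ x) inv = cong (ℕ._+ ∑ᵢ g as T x) (inv b)
∑ᵢ-flipʳ g (suc i) (a ∷ as) (t ∷ T) (b ∷ x) inv = cong (g a t b ℕ.+_) (∑ᵢ-flipʳ g i as T x inv)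

∑ᵢ-flipᵐ : ∀ {n} g (i : Fin n) a T x →
  (∀ t → g (lookup a i) (not t) (lookup x i) ≡ g (lookup a i) t (lookup x i)) →
  ∑ᵢ g a (flipAt i T) x ≡ ∑ᵢ g a T x
∑ᵢ-flipᵐ g zero    (a ∷ as) (t ∷ T) (b ∷ x) inv = cong (ℕ._+ ∑ᵢ g as T x) (inv t)
∑ᵢ-flipᵐ g (suc i) (a ∷ as) (t ∷ T) (b ∷ x) inv = cong (g a t b ℕ.+_) (∑ᵢ-flipᵐ g i as T x inv)

outer : Bool → Bool → Bool → ℕ
outer a t b = if t then bitℕ a else bitℕ (not b)

inner : Bool → Bool → Bool → ℕ
inner a t b = if t then bitℕ a ℕ.+ bitℕ b else 1

outer-insensitive : ∀ {a t} → t ≡ true → ∀ b → outer a t (not b) ≡ outer a t b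
outer-insensitive refl b = refl

inner-insensitive : ∀ {a t} → t ≡ false → ∀ b → inner a t (not b) ≡ inner a t b
inner-insensitive refl b = refl

outer-complement : ∀ {a b} → b ≡ not a → ∀ t → outer a (not t) b ≡ outer a t b
outer-complement {true}  refl true  = refl
outer-complement {true}  refl false = refl
outer-complement {false} refl true  = refl
outer-complement {false} refl false = refl

∑ᵢ-inner : ∀ {n} (a T x : Cube n) → ∑ᵢ inner a T x ≡ ∑ᵢ outer a T x ℕ.+ weight x
∑ᵢ-inner []       []      []      = refl
∑ᵢ-inner (a ∷ as) (t ∷ T) (b ∷ x) = begin
  inner a t b ℕ.+ ∑ᵢ inner as T x
    ≡⟨ cong₂ ℕ._+_ (coordinate t b) (∑ᵢ-inner as T x) ⟩
  (outer a t b ℕ.+ bitℕ b) ℕ.+ (∑ᵢ outer as T x ℕ.+ weight x)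
    ≡⟨ interchange ℕ.+-commutativeSemigroup (outer a t b) _ _ _ ⟩
  (outer a t b ℕ.+ ∑ᵢ outer as T x) ℕ.+ (bitℕ b ℕ.+ weight x)
    ≡⟨ cong ((outer a t b ℕ.+ ∑ᵢ outer as T x) ℕ.+_) (weight-∷ b x) ⟨
  (outer a t b ℕ.+ ∑ᵢ outer as T x) ℕ.+ weight (b ∷ x) ∎
  where
  open ≡-Reasoning
  coordinate : ∀ t b → inner a t b ≡ outer a t b ℕ.+ bitℕ b
  coordinate true  b     = refl
  coordinate false true  = refl
  coordinate false false = refl

-- If 2|T| ≥ n the level depends on x only off T, otherwise only on T; the two choices differ by |x|.
level : ∀ {n} → Cube n → Cube n → Cube n → ℕ
level {n} a T x with n ℕ.≤? 2 ℕ.* weight T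
... | yes _ = ∑ᵢ outer a T x
... | no  _ = ∑ᵢ inner a T x

average-< : ∀ {s t n} → 2 ℕ.* s < n → 2 ℕ.* t < n → s ℕ.+ t < n
average-< {s} {t} {n} 2s<n 2t<n = ℕ.*-cancelˡ-< 2 (s ℕ.+ t) n
  (subst₂ _<_ (sym (ℕ.*-distribˡ-+ 2 s t)) (cong (n ℕ.+_) (sym (ℕ.+-identityʳ n))) (ℕ.+-mono-< 2s<n 2t<n))

level-invariant-coordinate : ∀ {n} (a S T : Cube n) → 2 ℕ.* weight S < n →
  ∃ λ i → lookup S i ≡ false × (∀ x → level a T (flipAt i x) ≡ level a T x)
level-invariant-coordinate {n} a S T 2|S|<n with n ℕ.≤? 2 ℕ.* weight T
... | yes n≤2|T| =
  let i , Tᵢ , Sᵢ = ∃-member-of-difference S T (ℕ.*-cancelˡ-< 2 _ _ (ℕ.<-≤-trans 2|S|<n n≤2|T|))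
  in  i , Sᵢ , λ x → ∑ᵢ-flipʳ outer i a T x (outer-insensitive Tᵢ)
... | no n≰2|T| =
  let i , Sᵢ , Tᵢ = ∃-nonmember-of-union S T (average-< {weight S} 2|S|<n (ℕ.≰⇒> n≰2|T|))
  in  i , Sᵢ , λ x → ∑ᵢ-flipʳ inner i a T x (inner-insensitive Tᵢ)

module _ (q : ℕ) where

  θ : ∀ {n} → Cube n → ℕ → Cube n → Cube n → ℤ
  θ a r T x = σ T * σ x * 𝟙[ q ∣ level a T x ℕ.+ r ]

  φ : ∀ {n} → Cube n → ℕ → Cube n → ℤ
  φ a r x = ∑ (λ T → θ a r T x)

  ψ : ∀ {n} → Cube n → ℕ → Cube n → ℤ
  ψ a r x = ∑ (λ T → σ T * σ x * 𝟙[ q ∣ ∑ᵢ outer a T x ℕ.+ r ])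

  θ-odd : ∀ {n} (a : Cube n) r T (i : Fin n) → (∀ x → level a T (flipAt i x) ≡ level a T x) →
    ∀ x → θ a r T (flipAt i x) ≡ - θ a r T x
  θ-odd a r T i invariant x = begin
    σ T * σ (flipAt i x) * 𝟙[ q ∣ level a T (flipAt i x) ℕ.+ r ]
      ≡⟨ cong₂ (λ s l → σ T * s * 𝟙[ q ∣ l ℕ.+ r ]) (σ-flip i x) (invariant x) ⟩
    σ T * - σ x * 𝟙[ q ∣ level a T x ℕ.+ r ]
      ≡⟨ negate-middle (σ T) (σ x) _ ⟩
    - θ a r T x ∎
    where
    open ≡-Reasoning
    negate-middle : ∀ a b c → a * - b * c ≡ - (a * b * c)
    negate-middle = solve-∀

  φ-orthogonal : ∀ {n} (a : Cube n) r S → 2 ℕ.* weight S < n → ∑ (λ x → monomial S x * φ a r x) ≡ + 0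
  φ-orthogonal {n} a r S 2|S|<n = begin
    ∑ (λ x → monomial S x * ∑ (λ T → θ a r T x))
      ≡⟨ ∑-cong (λ x → ∑-*ˡ (monomial S x) (λ T → θ a r T x)) ⟨
    ∑ (λ x → ∑ (λ T → monomial S x * θ a r T x))  ≡⟨ ∑-swap (λ x T → monomial S x * θ a r T x) ⟩
    ∑ (λ T → ∑ (λ x → monomial S x * θ a r T x))  ≡⟨ ∑-cong θ-orthogonal ⟩
    ∑ {n} (λ _ → + 0)                             ≡⟨ ∑-0 {n} ⟩
    + 0                                           ∎
    where
    open ≡-Reasoning
    θ-orthogonal : ∀ T → ∑ (λ x → monomial S x * θ a r T x) ≡ + 0
    θ-orthogonal T =
      let i , Sᵢ , invariant = level-invariant-coordinate a S T 2|S|<n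
      in  ∑-monomial-odd i S (θ a r T) Sᵢ (θ-odd a r T i invariant)

  θ-on-multiples : ∀ {n} (a : Cube n) r T x → q ℕ.∣ weight x →
    θ a r T x ≡ σ T * σ x * 𝟙[ q ∣ ∑ᵢ outer a T x ℕ.+ r ]
  θ-on-multiples {n} a r T x q∣x with n ℕ.≤? 2 ℕ.* weight T
  ... | yes _ = refl
  ... | no  _ = cong (λ v → σ T * σ x * v) (begin
    𝟙[ q ∣ ∑ᵢ inner a T x ℕ.+ r ]
      ≡⟨ cong (λ l → 𝟙[ q ∣ l ℕ.+ r ]) (∑ᵢ-inner a T x) ⟩
    𝟙[ q ∣ ∑ᵢ outer a T x ℕ.+ weight x ℕ.+ r ]
      ≡⟨ cong 𝟙[ q ∣_] (xy∙z≈xz∙y ℕ.+-commutativeSemigroup (∑ᵢ outer a T x) (weight x) r) ⟩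
    𝟙[ q ∣ ∑ᵢ outer a T x ℕ.+ r ℕ.+ weight x ]
      ≡⟨ 𝟙-shift q∣x ⟩
    𝟙[ q ∣ ∑ᵢ outer a T x ℕ.+ r ] ∎)
    where open ≡-Reasoning

  φ-on-multiples : ∀ {n} (a : Cube n) r x → q ℕ.∣ weight x → φ a r x ≡ ψ a r x
  φ-on-multiples a r x q∣x = ∑-cong λ T → θ-on-multiples a r T x q∣x

  ψ-off-diagonal : ∀ {n} (a : Cube n) r x → x ≢ a → ψ a r x ≡ + 0
  ψ-off-diagonal a r x x≢a with distinct-coordinate x≢a
  ... | i , xᵢ≢aᵢ = ∑-odd i _ λ T → begin
    σ (flipAt i T) * σ x * 𝟙[ q ∣ ∑ᵢ outer a (flipAt i T) x ℕ.+ r ]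
      ≡⟨ cong₂ (λ s l → s * σ x * 𝟙[ q ∣ l ℕ.+ r ]) (σ-flip i T)
               (∑ᵢ-flipᵐ outer i a T x (outer-complement (¬-not xᵢ≢aᵢ))) ⟩
    - σ T * σ x * 𝟙[ q ∣ ∑ᵢ outer a T x ℕ.+ r ]
      ≡⟨ negate-left (σ T) (σ x) _ ⟩
    - (σ T * σ x * 𝟙[ q ∣ ∑ᵢ outer a T x ℕ.+ r ]) ∎
    where
    open ≡-Reasoning
    negate-left : ∀ a b c → - a * b * c ≡ - (a * b * c)
    negate-left = solve-∀

  ψ-step : ∀ {n} b (a : Cube n) r → ψ (b ∷ a) r (b ∷ a) ≡ ψ a (suc r) a - ψ a r a
  ψ-step {n} b a r = by-cases b
    where
    open ≡-Reasoning
    L : Cube n → ℕ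
    L T = ∑ᵢ outer a T a
    u : ℕ → Cube n → ℤ
    u r T = σ T * σ a * 𝟙[ q ∣ L T ℕ.+ r ]
    shift : ∀ T → 𝟙[ q ∣ suc (L T ℕ.+ r) ] ≡ 𝟙[ q ∣ L T ℕ.+ suc r ]
    shift T = cong 𝟙[ q ∣_] (sym (ℕ.+-suc (L T) r))
    sign⁻⁺ : ∀ s s′ v → -1ℤ * s * (+ 1 * s′) * v ≡ - (s * s′ * v)
    sign⁻⁺ = solve-∀
    sign⁺⁺ : ∀ s s′ → + 1 * s * (+ 1 * s′) ≡ s * s′
    sign⁺⁺ = solve-∀
    sign⁻⁻ : ∀ s s′ → -1ℤ * s * (-1ℤ * s′) ≡ s * s′
    sign⁻⁻ = solve-∀
    sign⁺⁻ : ∀ s s′ v → + 1 * s * (-1ℤ * s′) * v ≡ - (s * s′ * v)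
    sign⁺⁻ = solve-∀
    by-cases : ∀ b → ψ (b ∷ a) r (b ∷ a) ≡ ψ a (suc r) a - ψ a r a
    by-cases true = begin
      ∑ (λ T → -1ℤ * σ T * (+ 1 * σ a) * 𝟙[ q ∣ L T ℕ.+ r ]) +
      ∑ (λ T → + 1 * σ T * (+ 1 * σ a) * 𝟙[ q ∣ suc (L T ℕ.+ r) ])
        ≡⟨ cong₂ _+_ (∑-cong {n} λ T → sign⁻⁺ (σ T) (σ a) 𝟙[ q ∣ L T ℕ.+ r ])
                     (∑-cong {n} λ T → cong₂ _*_ (sign⁺⁺ (σ T) (σ a)) (shift T)) ⟩
      ∑ (λ T → - u r T) + ∑ (u (suc r))       ≡⟨ cong (_+ ∑ (u (suc r))) (∑-neg (u r)) ⟩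
      - ψ a r a + ψ a (suc r) a                ≡⟨ +-comm (- ψ a r a) _ ⟩
      ψ a (suc r) a - ψ a r a                  ∎
    by-cases false = begin
      ∑ (λ T → -1ℤ * σ T * (-1ℤ * σ a) * 𝟙[ q ∣ suc (L T ℕ.+ r) ]) +
      ∑ (λ T → + 1 * σ T * (-1ℤ * σ a) * 𝟙[ q ∣ L T ℕ.+ r ])
        ≡⟨ cong₂ _+_ (∑-cong {n} λ T → cong₂ _*_ (sign⁻⁻ (σ T) (σ a)) (shift T))
                     (∑-cong {n} λ T → sign⁺⁻ (σ T) (σ a) 𝟙[ q ∣ L T ℕ.+ r ]) ⟩
      ∑ (u (suc r)) + ∑ (λ T → - u r T)       ≡⟨ cong (λ v → ∑ (u (suc r)) + v) (∑-neg (u r)) ⟩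
      ψ a (suc r) a - ψ a r a                  ∎

  ψ-diagonal : ∀ {n} (a : Cube n) r → ψ a r a ≡ Δ^ n 𝟙[ q ∣_] r
  ψ-diagonal []      r = *-identityˡ 𝟙[ q ∣ r ]
  ψ-diagonal (b ∷ a) r = trans (ψ-step b a r) (cong₂ _-_ (ψ-diagonal a (suc r)) (ψ-diagonal a r))

∑-evalML-* : ∀ {n} (c h : Cube n → ℤ) →
  ∑ (λ x → evalML c x * h x) ≡ ∑ (λ S → c S * ∑ (λ x → monomial S x * h x))
∑-evalML-* {n} c h = begin
  ∑ (λ x → evalML c x * h x)
    ≡⟨ ∑-cong (λ x → trans (cong (_* h x) (sumℤ-allCube n _))
                           (sym (∑-*ʳ (h x) (λ S → c S * monomial S x)))) ⟩
  ∑ (λ x → ∑ (λ S → c S * monomial S x * h x))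
    ≡⟨ ∑-swap (λ x S → c S * monomial S x * h x) ⟩
  ∑ (λ S → ∑ (λ x → c S * monomial S x * h x))
    ≡⟨ ∑-cong (λ S → trans (∑-cong (λ x → *-assoc (c S) (monomial S x) (h x)))
                           (∑-*ˡ (c S) (λ x → monomial S x * h x))) ⟩
  ∑ (λ S → c S * ∑ (λ x → monomial S x * h x)) ∎
  where open ≡-Reasoning

∣-∑-evalML-* : ∀ {d n} (c h : Cube n → ℤ) →
  (∀ S → d ∣ c S ⊎ ∑ (λ x → monomial S x * h x) ≡ + 0) → d ∣ ∑ (λ x → evalML c x * h x)
∣-∑-evalML-* {d} c h d∣c⊎orthogonal = subst (d ∣_) (sym (∑-evalML-* c h)) (∣-∑ term)
  where
  term : ∀ S → d ∣ c S * ∑ (λ x → monomial S x * h x)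
  term S with d∣c⊎orthogonal S
  ... | inj₁ d∣c        = ∣m⇒∣m*n _ d∣c
  ... | inj₂ orthogonal = ≡0⇒∣ (trans (cong (c S *_) orthogonal) (*-zeroʳ (c S)))

low-degree⇒vanishes : ∀ {p q n} → 2 ≤ q → Coprime q p → (f c : Cube n → ℤ) →
  (∀ x → ¬ q ℕ.∣ weight x → + p ∣ f x) →
  (∀ x → + p ∣ evalML c x - f x) →
  (∀ S → + p ∣ c S ⊎ 2 ℕ.* weight S < n) →
  ∀ a → + p ∣ f a
low-degree⇒vanishes {p} {q} {n} 2≤q q⊥p f c p∣f-off p∣e-f low a with q ℕ.∣? weight a
... | no  q∤a = p∣f-off a q∤a
... | yes q∣a = Δ^𝟙-annihilator 2≤q q⊥p n (f a) p∣f[a]Δⁿ𝟙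
  where
  p∣f[a]Δⁿ𝟙 : ∀ r → + p ∣ f a * Δ^ n 𝟙[ q ∣_] r
  p∣f[a]Δⁿ𝟙 r = subst (+ p ∣_) (cong (f a *_) φ[a]) p∣f[a]φ[a]
    where
    e = evalML c
    h = φ q a r
    telescope : ∀ A B C → A - (A - B) - (B - C) ≡ C
    telescope = solve-∀
    distrib : ∀ u v w → (u - v) * w ≡ u * w - v * w
    distrib = solve-∀
    p∣∑eφ : + p ∣ ∑ (λ x → e x * h x)
    p∣∑eφ = ∣-∑-evalML-* c h (λ S → Sum.map₂ (φ-orthogonal q a r S) (low S))
    p∣∑eφ-∑fφ : + p ∣ ∑ (λ x → e x * h x) - ∑ (λ x → f x * h x)
    p∣∑eφ-∑fφ = ∣-∑-∑ λ x → subst (+ p ∣_) (distrib (e x) (f x) (h x)) (∣m⇒∣m*n (h x) (p∣e-f x))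
    p∣fφ-off : ∀ x → x ≢ a → + p ∣ f x * h x
    p∣fφ-off x x≢a with q ℕ.∣? weight x
    ... | no  q∤x = ∣m⇒∣m*n (h x) (p∣f-off x q∤x)
    ... | yes q∣x = ≡0⇒∣ (trans (cong (f x *_) (trans (φ-on-multiples q a r x q∣x)
                                                       (ψ-off-diagonal q a r x x≢a)))
                               (*-zeroʳ (f x)))
    p∣∑fφ-f[a]φ[a] : + p ∣ ∑ (λ x → f x * h x) - f a * h a
    p∣∑fφ-f[a]φ[a] = ∣-∑-at a (λ x → f x * h x) p∣fφ-off
    p∣f[a]φ[a] : + p ∣ f a * h a
    p∣f[a]φ[a] = subst (+ p ∣_) (telescope (∑ (λ x → e x * h x)) (∑ (λ x → f x * h x)) (f a * h a))
      (∣m∣n⇒∣m-n (∣m∣n⇒∣m-n p∣∑eφ p∣∑eφ-∑fφ) p∣∑fφ-f[a]φ[a])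
    φ[a] : h a ≡ Δ^ n 𝟙[ q ∣_] r
    φ[a] = trans (φ-on-multiples q a r a q∣a) (ψ-diagonal q a r)

mainTheorem1 : (p q n : ℕ) → Prime p → 2 ≤ q → Coprime q p →
    (f : Cube n → ℤ) →
    (Σ (Cube n → ℤ) λ g → ∀ x → f x ≡ g x ℤ.* χ q x [mod p ]) →
    (c : Cube n → ℤ) → (∀ x → evalML c x ≡ f x [mod p ]) →
    (∀ x → f x ≡ + 0 [mod p ]) ⊎
    (Σ (Cube n) λ S → ¬ (c S ≡ + 0 [mod p ]) × n ≤ 2 ℕ.* weight S)
mainTheorem1 p q n _ 2≤q q⊥p f (g , f≡gχ) c e≡f
  with anySubset? (λ S → ¬? (p ℕ.∣? ℤ.∣ c S - + 0 ∣) ×-dec (n ℕ.≤? 2 ℕ.* weight S))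
... | yes high-term = inj₂ high-term
... | no  ¬high-term = inj₁ λ a →
  ∣⇒∣ᵤ (subst (+ p ∣_) (sym (+-identityʳ (f a)))
    (low-degree⇒vanishes 2≤q q⊥p f c p∣f-off (∣ᵤ⇒∣ ∘ e≡f) low a))
  where
  p∣f-off : ∀ x → ¬ q ℕ.∣ weight x → + p ∣ f x
  p∣f-off x q∤x = subst (+ p ∣_) f-gχ≡f (∣ᵤ⇒∣ (f≡gχ x))
    where
    f-gχ≡f : f x - g x * χ q x ≡ f x
    f-gχ≡f rewrite 𝟙-no q∤x | *-zeroʳ (g x) = +-identityʳ (f x)
  low : ∀ S → + p ∣ c S ⊎ 2 ℕ.* weight S < n
  low S with p ℕ.∣? ℤ.∣ c S - + 0 ∣
  ... | yes p∣c = inj₁ (subst (+ p ∣_) (+-identityʳ (c S)) (∣ᵤ⇒∣ p∣c))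
  ... | no  p∤c = inj₂ (ℕ.≰⇒> λ high → ¬high-term (S , p∤c , high))
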